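{- For every integer $s$: for every non-negative integer $n$, \[ 2\sum_{k = 0}^n \binom{2n}{2k} \frac{F_{6k + s}}{5^k} =\left(\frac{4}{5}\right)^{n}\bigl(4^{n} F_{2n + s} + F_s\bigr),\qquad 2\sum_{k = 0}^n \binom{2n}{2k} \frac{L_{6k + s}}{5^k} = \left(\frac{4}{5}\right)^{n} \bigl( 4^n L_{2n + s} + L_s\bigr), \] and for every positive integer $n$, \[ 8\sum_{k = 0}^n \binom{2n - 1}{2k}\frac{F_{6k + s}}{5^k} = \left(\frac{4}{5}\right)^{n} \bigl(4^{n} L_{2n - 1 + s} -2 L_s\bigr),\qquad 2\sum_{k = 0}^n \binom{2n - 1}{2k}\frac{ L_{6k + s}}{5^k} =\left(\frac{4}{5}\right)^{n-1} \bigl(4^{n}F_{2n - 1 + s} - 2F_s\bigr), \] where $\binom{2n-1}{2n}=0$.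
   Context: The Fibonacci numbers $F_j$ and Lucas numbers $L_j$ are defined for all integers $j$ by $F_0=0$, $F_1=1$, $L_0=2$, $L_1=1$, $F_j=F_{j-1}+F_{j-2}$, $L_j=L_{j-1}+L_{j-2}$, with $F_{ -j}=(-1)^{j-1}F_j$ and $L_{ -j}=(-1)^jL_j$. -}

module Defs where

open import Data.Nat as ℕ using (ℕ; zero; suc)
open import Data.Nat.Combinatorics using (_C_)
open import Data.Integer as ℤ using (ℤ; +_; -[1+_])
open import Data.Rational as ℚ using (ℚ)

fibℕ : ℕ → ℤ
fibℕ zero = + 0
fibℕ (suc zero) = + 1
fibℕ (suc (suc n)) = fibℕ (suc n) ℤ.+ fibℕ n

lucℕ : ℕ → ℤ
lucℕ zero = + 2
lucℕ (suc zero) = + 1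
lucℕ (suc (suc n)) = lucℕ (suc n) ℤ.+ lucℕ n

sgn : ℕ → ℤ
sgn zero = + 1
sgn (suc j) = ℤ.- sgn j

-- extension to all integers: F_{-j} = (-1)^{j-1} F_j, L_{-j} = (-1)^j L_j
F : ℤ → ℤ
F (+ n) = fibℕ n
F -[1+ n ] = sgn n ℤ.* fibℕ (suc n)

L : ℤ → ℤ
L (+ n) = lucℕ n
L -[1+ n ] = sgn (suc n) ℤ.* lucℕ (suc n)

_^ℚ_ : ℚ → ℕ → ℚ
q ^ℚ zero = ℚ.1ℚ
q ^ℚ suc n = q ℚ.* (q ^ℚ n)

sumTo : ℕ → (ℕ → ℚ) → ℚ
sumTo zero f = f 0
sumTo (suc n) f = sumTo n f ℚ.+ f (suc n)

ι : ℤ → ℚ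
ι z = z ℚ./ 1

ιℕ : ℕ → ℚ
ιℕ n = ι (+ n)

-- Write D for the operator X ↦ X(· + 1) + X(· - 1) and E for the shift X ↦ X(· + 1) on sequences
-- ℤ → ℚ. On Gibonacci sequences one has D² = 5, D + E³ = 4E and D - E³ = -2: on φᵗ and ψᵗ, D acts as
-- ±√5 and E³ as φ³ = 2 + √5, ψ³ = 2 - √5. Expanding (D + εE³)ᵐ X by the binomial theorem for ε = ±1
-- and adding the two expansions keeps only the terms C(m,2k) D^(m-2k) E^(6k) X, where D^(2i) = 5ⁱ.
-- For m = 2n this is the even identity after dividing by 5ⁿ; for m = 2n + 1 one factor D remains,
-- and D F = L, D L = 5F exchange the roles of F and L.

module Submission where

open import Defs
open import Data.Nat as ℕ using (ℕ; zero; suc; _∸_)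
open import Data.Nat.Combinatorics using (_C_; nCk+nC[k+1]≡[n+1]C[k+1]; k>n⇒nCk≡0)
open import Data.Nat.GeneralisedArithmetic using (fold)
open import Data.Integer as ℤ using (ℤ; +_; -[1+_])
open import Data.Rational as ℚ using (ℚ; mkℚ; 0ℚ; 1ℚ; _+_; _*_; -_)
open import Data.Product using (_×_; _,_)
open import Function.Base using (_∘_)
open import Algebra.Bundles using (CommutativeMonoid)
open import Relation.Binary.PropositionalEquality
import Data.Nat.Properties as ℕP
import Data.Integer.Properties as ℤP
import Data.Rational.Properties as ℚP
import Data.Nat.Coprimality as Coprimality
import Algebra.Properties.CommutativeSemigroup ℤP.+-commutativeSemigroup as ℤ+
import Algebra.Properties.CommutativeSemigroup (CommutativeMonoid.commutativeSemigroup ℚP.+-0-commutativeMonoid) as ℚ+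
import Algebra.Properties.CommutativeSemigroup (CommutativeMonoid.commutativeSemigroup ℚP.*-1-commutativeMonoid) as ℚ*
import Data.Rational.Solver
import Data.Integer.Solver
module ℚSolver = Data.Rational.Solver.+-*-Solver
module ℤSolver = Data.Integer.Solver.+-*-Solver
open ≡-Reasoning

lucℕ[1+n]≡fibℕ[2+n]+fibℕ[n] : ∀ n → lucℕ (suc n) ≡ fibℕ (suc (suc n)) ℤ.+ fibℕ n
lucℕ[1+n]≡fibℕ[2+n]+fibℕ[n] zero = refl
lucℕ[1+n]≡fibℕ[2+n]+fibℕ[n] (suc zero) = refl
lucℕ[1+n]≡fibℕ[2+n]+fibℕ[n] (suc (suc n)) = begin
  lucℕ (2 ℕ.+ n) ℤ.+ lucℕ (suc n)
    ≡⟨ cong₂ ℤ._+_ (lucℕ[1+n]≡fibℕ[2+n]+fibℕ[n] (suc n)) (lucℕ[1+n]≡fibℕ[2+n]+fibℕ[n] n) ⟩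
  (fibℕ (3 ℕ.+ n) ℤ.+ fibℕ (suc n)) ℤ.+ (fibℕ (2 ℕ.+ n) ℤ.+ fibℕ n)
    ≡⟨ ℤ+.interchange (fibℕ (3 ℕ.+ n)) _ _ _ ⟩
  fibℕ (4 ℕ.+ n) ℤ.+ fibℕ (2 ℕ.+ n) ∎

F-recurrence : ∀ t → F (ℤ.suc (ℤ.suc t)) ≡ F (ℤ.suc t) ℤ.+ F t
F-recurrence (+ n) = refl
F-recurrence -[1+ 0 ] = refl
F-recurrence -[1+ 1 ] = refl
F-recurrence -[1+ suc (suc n) ] = solve 3
  (λ σ a b → σ :* a := (:- σ) :* (a :+ b) :+ (:- (:- σ)) :* ((a :+ b) :+ a))
  refl (sgn n) (fibℕ (suc n)) (fibℕ n)
  where open ℤSolver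

L≡F[t+1]+F[t-1] : ∀ t → L t ≡ F (ℤ.suc t) ℤ.+ F (ℤ.pred t)
L≡F[t+1]+F[t-1] (+ zero) = refl
L≡F[t+1]+F[t-1] (+ suc n) = lucℕ[1+n]≡fibℕ[2+n]+fibℕ[n] n
L≡F[t+1]+F[t-1] -[1+ zero ] = refl
L≡F[t+1]+F[t-1] -[1+ suc n ] = begin
  ℤ.- (ℤ.- sgn n) ℤ.* lucℕ (suc (suc n))
    ≡⟨ cong (ℤ.- (ℤ.- sgn n) ℤ.*_) (lucℕ[1+n]≡fibℕ[2+n]+fibℕ[n] (suc n)) ⟩
  ℤ.- (ℤ.- sgn n) ℤ.* (fibℕ (3 ℕ.+ n) ℤ.+ fibℕ (suc n))
    ≡⟨ solve 3 (λ σ a b → (:- (:- σ)) :* (a :+ b) := σ :* b :+ (:- (:- σ)) :* a)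
         refl (sgn n) (fibℕ (3 ℕ.+ n)) (fibℕ (suc n)) ⟩
  sgn n ℤ.* fibℕ (suc n) ℤ.+ ℤ.- (ℤ.- sgn n) ℤ.* fibℕ (3 ℕ.+ n) ∎
  where open ℤSolver

ι-canonical : ∀ z → ι z ≡ mkℚ z 0 (Coprimality.sym (Coprimality.1-coprimeTo _))
ι-canonical z = ℚP.↥p/↧p≡p (mkℚ z 0 (Coprimality.sym (Coprimality.1-coprimeTo _)))

-- Both sides reduce to the same fraction once the arguments are in canonical form.
ι-+ : ∀ a b → ι (a ℤ.+ b) ≡ ι a + ι b
ι-+ a b = trans (cong ι (cong₂ ℤ._+_ (sym (ℤP.*-identityʳ a)) (sym (ℤP.*-identityʳ b))))
                (sym (cong₂ _+_ (ι-canonical a) (ι-canonical b)))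

ι-* : ∀ a b → ι (a ℤ.* b) ≡ ι a * ι b
ι-* a b = sym (cong₂ _*_ (ι-canonical a) (ι-canonical b))

ι-^ : ∀ z n → ι (z ℤ.^ n) ≡ ι z ^ℚ n
ι-^ z zero = refl
ι-^ z (suc n) = trans (ι-* z (z ℤ.^ n)) (cong (ι z *_) (ι-^ z n))

^ℚ-distrib-* : ∀ p q n → (p * q) ^ℚ n ≡ p ^ℚ n * q ^ℚ n
^ℚ-distrib-* p q zero = refl
^ℚ-distrib-* p q (suc n) = begin
  (p * q) * (p * q) ^ℚ n       ≡⟨ cong ((p * q) *_) (^ℚ-distrib-* p q n) ⟩
  (p * q) * (p ^ℚ n * q ^ℚ n)  ≡⟨ ℚ*.interchange p q (p ^ℚ n) (q ^ℚ n) ⟩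
  (p * p ^ℚ n) * (q * q ^ℚ n)  ∎

^ℚ-double : ∀ q n → q ^ℚ (2 ℕ.* n) ≡ (q * q) ^ℚ n
^ℚ-double q zero = refl
^ℚ-double q (suc n) = begin
  q ^ℚ (2 ℕ.* suc n)       ≡⟨ cong (q ^ℚ_) (ℕP.*-suc 2 n) ⟩
  q * (q * q ^ℚ (2 ℕ.* n)) ≡⟨ sym (ℚP.*-assoc q q _) ⟩
  (q * q) * q ^ℚ (2 ℕ.* n) ≡⟨ cong ((q * q) *_) (^ℚ-double q n) ⟩
  (q * q) * (q * q) ^ℚ n   ∎

1^ℚ : ∀ n → 1ℚ ^ℚ n ≡ 1ℚ
1^ℚ zero = refl
1^ℚ (suc n) = trans (ℚP.*-identityˡ _) (1^ℚ n)

^ℚ-even : ∀ {ε} → ε * ε ≡ 1ℚ → ∀ k → ε ^ℚ (2 ℕ.* k) ≡ 1ℚ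
^ℚ-even {ε} ε²≡1 k = trans (^ℚ-double ε k) (trans (cong (_^ℚ k) ε²≡1) (1^ℚ k))

^ℚ-cancel : ∀ {p q} → p * q ≡ 1ℚ → ∀ d k → p ^ℚ d * q ^ℚ (d ℕ.+ k) ≡ q ^ℚ k
^ℚ-cancel pq≡1 zero k = ℚP.*-identityˡ _
^ℚ-cancel {p} {q} pq≡1 (suc d) k = begin
  (p * p ^ℚ d) * (q * q ^ℚ (d ℕ.+ k)) ≡⟨ ℚ*.interchange p (p ^ℚ d) q _ ⟩
  (p * q) * (p ^ℚ d * q ^ℚ (d ℕ.+ k)) ≡⟨ cong₂ _*_ pq≡1 (^ℚ-cancel pq≡1 d k) ⟩
  1ℚ * q ^ℚ k                         ≡⟨ ℚP.*-identityˡ _ ⟩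
  q ^ℚ k                              ∎

sumTo-cong : ∀ n {f g : ℕ → ℚ} → (∀ k → k ℕ.≤ n → f k ≡ g k) → sumTo n f ≡ sumTo n g
sumTo-cong zero f≗g = f≗g 0 ℕ.z≤n
sumTo-cong (suc n) f≗g =
  cong₂ _+_ (sumTo-cong n (λ k k≤n → f≗g k (ℕP.m≤n⇒m≤1+n k≤n))) (f≗g (suc n) ℕP.≤-refl)

sumTo-+ : ∀ n (f g : ℕ → ℚ) → sumTo n (λ k → f k + g k) ≡ sumTo n f + sumTo n g
sumTo-+ zero f g = refl
sumTo-+ (suc n) f g = trans (cong (_+ (f (suc n) + g (suc n))) (sumTo-+ n f g))
                            (ℚ+.interchange (sumTo n f) (sumTo n g) (f (suc n)) (g (suc n)))

sumTo-*ˡ : ∀ n c (f : ℕ → ℚ) → sumTo n (λ k → c * f k) ≡ c * sumTo n f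
sumTo-*ˡ zero c f = refl
sumTo-*ˡ (suc n) c f = trans (cong (_+ c * f (suc n)) (sumTo-*ˡ n c f))
                             (sym (ℚP.*-distribˡ-+ c (sumTo n f) (f (suc n))))

sumTo-suc-head : ∀ n (f : ℕ → ℚ) → sumTo (suc n) f ≡ f 0 + sumTo n (f ∘ suc)
sumTo-suc-head zero f = refl
sumTo-suc-head (suc n) f = trans (cong (_+ f (2 ℕ.+ n)) (sumTo-suc-head n f))
                                 (ℚP.+-assoc (f 0) _ _)

sumTo-suc-zero : ∀ n (f : ℕ → ℚ) → f (suc n) ≡ 0ℚ → sumTo (suc n) f ≡ sumTo n f
sumTo-suc-zero n f fₙ₊₁≡0 = trans (cong (λ x → sumTo n f + x) fₙ₊₁≡0) (ℚP.+-identityʳ _)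

sumTo-rescale : ∀ {p q} → p * q ≡ 1ℚ → ∀ n (f : ℕ → ℚ) →
  sumTo n (λ k → f k * q ^ℚ k) ≡ q ^ℚ n * sumTo n (λ k → p ^ℚ (n ∸ k) * f k)
sumTo-rescale {p} {q} pq≡1 n f =
  trans (sumTo-cong n term) (sumTo-*ˡ n (q ^ℚ n) (λ k → p ^ℚ (n ∸ k) * f k))
  where
  term : ∀ k → k ℕ.≤ n → f k * q ^ℚ k ≡ q ^ℚ n * (p ^ℚ (n ∸ k) * f k)
  term k k≤n = begin
    f k * q ^ℚ k                                ≡⟨ cong (f k *_) (sym (^ℚ-cancel pq≡1 (n ∸ k) k)) ⟩
    f k * (p ^ℚ (n ∸ k) * q ^ℚ ((n ∸ k) ℕ.+ k))
      ≡⟨ cong (λ e → f k * (p ^ℚ (n ∸ k) * q ^ℚ e)) (ℕP.m∸n+n≡m k≤n) ⟩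
    f k * (p ^ℚ (n ∸ k) * q ^ℚ n)
      ≡⟨ solve 3 (λ x y z → x :* (y :* z) := z :* (y :* x)) refl (f k) (p ^ℚ (n ∸ k)) (q ^ℚ n) ⟩
    q ^ℚ n * (p ^ℚ (n ∸ k) * f k) ∎
    where open ℚSolver

ιℕ-pascal : ∀ m j → ιℕ (suc m C suc j) ≡ ιℕ (m C j) + ιℕ (m C suc j)
ιℕ-pascal m j = trans (cong ιℕ (sym (nCk+nC[k+1]≡[n+1]C[k+1] m j))) (ι-+ (+ (m C j)) (+ (m C suc j)))

sumTo-pascal : ∀ m (g : ℕ → ℕ → ℚ) →
  sumTo (suc m) (λ j → ιℕ (suc m C j) * g (suc m ∸ j) j)
    ≡ sumTo m (λ j → ιℕ (m C j) * g (suc (m ∸ j)) j) + sumTo m (λ j → ιℕ (m C j) * g (m ∸ j) (suc j))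
sumTo-pascal m g = begin
  sumTo (suc m) (λ j → ιℕ (suc m C j) * g (suc m ∸ j) j)
    ≡⟨ sumTo-suc-head m _ ⟩
  g₀ + sumTo m (λ j → ιℕ (suc m C suc j) * g (m ∸ j) (suc j))
    ≡⟨ cong (λ x → g₀ + x) (trans (sumTo-cong m (λ j _ → split j)) (sumTo-+ m _ _)) ⟩
  g₀ + (B + D)
    ≡⟨ solve 3 (λ x y z → x :+ (y :+ z) := (x :+ z) :+ y) refl g₀ B D ⟩
  (g₀ + D) + B
    ≡⟨ cong (_+ B) (sym (sumTo-suc-head m _)) ⟩
  sumTo (suc m) (λ j → ιℕ (m C j) * g (suc m ∸ j) j) + B
    ≡⟨ cong (_+ B) (sumTo-suc-zero m _ lastTerm≡0) ⟩
  sumTo m (λ j → ιℕ (m C j) * g (suc m ∸ j) j) + B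
    ≡⟨ cong (_+ B) (sumTo-cong m (λ j j≤m → cong (λ i → ιℕ (m C j) * g i j) (ℕP.+-∸-assoc 1 j≤m))) ⟩
  sumTo m (λ j → ιℕ (m C j) * g (suc (m ∸ j)) j) + B ∎
  where
  open ℚSolver
  g₀ B D : ℚ
  g₀ = ιℕ (suc m C 0) * g (suc m) 0
  B = sumTo m (λ j → ιℕ (m C j) * g (m ∸ j) (suc j))
  D = sumTo m (λ j → ιℕ (m C suc j) * g (m ∸ j) (suc j))
  lastTerm≡0 : ιℕ (m C suc m) * g (m ∸ m) (suc m) ≡ 0ℚ
  lastTerm≡0 = trans (cong (λ c → ιℕ c * g (m ∸ m) (suc m)) (k>n⇒nCk≡0 (ℕP.n<1+n m)))
                     (ℚP.*-zeroˡ (g (m ∸ m) (suc m)))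
  split : ∀ j → ιℕ (suc m C suc j) * g (m ∸ j) (suc j)
              ≡ ιℕ (m C j) * g (m ∸ j) (suc j) + ιℕ (m C suc j) * g (m ∸ j) (suc j)
  split j = trans (cong (_* g (m ∸ j) (suc j)) (ιℕ-pascal m j))
                  (ℚP.*-distribʳ-+ (g (m ∸ j) (suc j)) (ιℕ (m C j)) (ιℕ (m C suc j)))

+3+t≡suc³t : ∀ t → + 3 ℤ.+ t ≡ ℤ.suc (ℤ.suc (ℤ.suc t))
+3+t≡suc³t t = trans (ℤP.+-assoc (+ 1) (+ 2) t) (cong ℤ.suc (ℤP.+-assoc (+ 1) (+ 1) t))

record IsGibonacci (X : ℤ → ℚ) : Set where
  constructor gibonacci
  field recurrence : ∀ t → X (ℤ.suc (ℤ.suc t)) ≡ X (ℤ.suc t) + X t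

neighbourSum : (ℤ → ℚ) → ℤ → ℚ
neighbourSum X t = X (ℤ.suc t) + X (ℤ.pred t)

neighbourSum^ : ℕ → (ℤ → ℚ) → ℤ → ℚ
neighbourSum^ k X = fold X neighbourSum k

module _ {X : ℤ → ℚ} (gib : IsGibonacci X) where

  private
    rec : ∀ t → X (ℤ.suc (ℤ.suc t)) ≡ X (ℤ.suc t) + X t
    rec = IsGibonacci.recurrence gib

  gibonacci-pred : ∀ t → X (ℤ.suc t) ≡ X t + X (ℤ.pred t)
  gibonacci-pred t = subst (λ u → X (ℤ.suc u) ≡ X u + X (ℤ.pred t)) (ℤP.suc-pred t) (rec (ℤ.pred t))

  gibonacci-shift³ : ∀ t → X (+ 3 ℤ.+ t) ≡ (X (ℤ.suc t) + X t) + X (ℤ.suc t)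
  gibonacci-shift³ t = begin
    X (+ 3 ℤ.+ t)                         ≡⟨ cong X (+3+t≡suc³t t) ⟩
    X (ℤ.suc (ℤ.suc (ℤ.suc t)))          ≡⟨ rec (ℤ.suc t) ⟩
    X (ℤ.suc (ℤ.suc t)) + X (ℤ.suc t)    ≡⟨ cong (_+ X (ℤ.suc t)) (rec t) ⟩
    (X (ℤ.suc t) + X t) + X (ℤ.suc t)    ∎

  neighbourSum-gibonacci : IsGibonacci (neighbourSum X)
  neighbourSum-gibonacci = gibonacci λ t → begin
    X (ℤ.suc (ℤ.suc (ℤ.suc t))) + X (ℤ.pred (ℤ.suc (ℤ.suc t)))
      ≡⟨ cong₂ _+_ (rec (ℤ.suc t)) (trans (cong X (ℤP.pred-suc (ℤ.suc t))) (gibonacci-pred t)) ⟩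
    (X (ℤ.suc (ℤ.suc t)) + X (ℤ.suc t)) + (X t + X (ℤ.pred t))
      ≡⟨ ℚ+.interchange (X (ℤ.suc (ℤ.suc t))) _ _ _ ⟩
    (X (ℤ.suc (ℤ.suc t)) + X t) + (X (ℤ.suc t) + X (ℤ.pred t))
      ≡⟨ cong (λ u → (X (ℤ.suc (ℤ.suc t)) + X u) + neighbourSum X t) (sym (ℤP.pred-suc t)) ⟩
    neighbourSum X (ℤ.suc t) + neighbourSum X t ∎

  neighbourSum-square : ∀ t → neighbourSum (neighbourSum X) t ≡ ι (+ 5) * X t
  neighbourSum-square t = begin
    (X (ℤ.suc (ℤ.suc t)) + X (ℤ.pred (ℤ.suc t))) + (X (ℤ.suc (ℤ.pred t)) + X (ℤ.pred (ℤ.pred t)))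
      ≡⟨ cong₂ (λ u v → (X (ℤ.suc (ℤ.suc t)) + X u) + (X v + X (ℤ.pred (ℤ.pred t))))
               (ℤP.pred-suc t) (ℤP.suc-pred t) ⟩
    (X (ℤ.suc (ℤ.suc t)) + X t) + (X t + X (ℤ.pred (ℤ.pred t)))
      ≡⟨ cong (λ u → (u + X t) + (X t + X (ℤ.pred (ℤ.pred t)))) (trans (rec t) (cong (_+ X t) (gibonacci-pred t))) ⟩
    ((X t + X (ℤ.pred t)) + X t + X t) + (X t + X (ℤ.pred (ℤ.pred t)))
      ≡⟨ solve 3 (λ x y z → ((x :+ y) :+ x :+ x) :+ (x :+ z) := con (ι (+ 4)) :* x :+ (y :+ z)) refl
           (X t) (X (ℤ.pred t)) (X (ℤ.pred (ℤ.pred t))) ⟩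
    ι (+ 4) * X t + (X (ℤ.pred t) + X (ℤ.pred (ℤ.pred t)))
      ≡⟨ cong (λ u → ι (+ 4) * X t + u) (sym (trans (cong X (sym (ℤP.suc-pred t))) (gibonacci-pred (ℤ.pred t)))) ⟩
    ι (+ 4) * X t + X t
      ≡⟨ solve 1 (λ x → con (ι (+ 4)) :* x :+ x := con (ι (+ 5)) :* x) refl (X t) ⟩
    ι (+ 5) * X t ∎
    where open ℚSolver

  neighbourSum+shift³ : ∀ t → neighbourSum X t + X (+ 3 ℤ.+ t) ≡ ι (+ 4) * X (ℤ.suc t)
  neighbourSum+shift³ t = begin
    (X (ℤ.suc t) + X (ℤ.pred t)) + X (+ 3 ℤ.+ t)
      ≡⟨ cong (λ u → neighbourSum X t + u) (gibonacci-shift³ t) ⟩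
    (X (ℤ.suc t) + X (ℤ.pred t)) + ((X (ℤ.suc t) + X t) + X (ℤ.suc t))
      ≡⟨ solve 3 (λ x y z → (x :+ z) :+ ((x :+ y) :+ x) := con (ι (+ 3)) :* x :+ (y :+ z)) refl
           (X (ℤ.suc t)) (X t) (X (ℤ.pred t)) ⟩
    ι (+ 3) * X (ℤ.suc t) + (X t + X (ℤ.pred t))
      ≡⟨ cong (λ u → ι (+ 3) * X (ℤ.suc t) + u) (sym (gibonacci-pred t)) ⟩
    ι (+ 3) * X (ℤ.suc t) + X (ℤ.suc t)
      ≡⟨ solve 1 (λ x → con (ι (+ 3)) :* x :+ x := con (ι (+ 4)) :* x) refl (X (ℤ.suc t)) ⟩
    ι (+ 4) * X (ℤ.suc t) ∎
    where open ℚSolver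

  neighbourSum-shift³ : ∀ t → neighbourSum X t + (- 1ℚ) * X (+ 3 ℤ.+ t) ≡ ι -[1+ 1 ] * X t
  neighbourSum-shift³ t = begin
    (X (ℤ.suc t) + X (ℤ.pred t)) + (- 1ℚ) * X (+ 3 ℤ.+ t)
      ≡⟨ cong (λ u → (X (ℤ.suc t) + X (ℤ.pred t)) + (- 1ℚ) * u) (gibonacci-shift³ t) ⟩
    (X (ℤ.suc t) + X (ℤ.pred t)) + (- 1ℚ) * ((X (ℤ.suc t) + X t) + X (ℤ.suc t))
      ≡⟨ solve 3 (λ x y z → (x :+ z) :+ con (- 1ℚ) :* ((x :+ y) :+ x) := con (- 1ℚ) :* (x :+ y) :+ z) refl
           (X (ℤ.suc t)) (X t) (X (ℤ.pred t)) ⟩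
    (- 1ℚ) * (X (ℤ.suc t) + X t) + X (ℤ.pred t)
      ≡⟨ cong (λ u → (- 1ℚ) * (u + X t) + X (ℤ.pred t)) (gibonacci-pred t) ⟩
    (- 1ℚ) * ((X t + X (ℤ.pred t)) + X t) + X (ℤ.pred t)
      ≡⟨ solve 2 (λ x y → con (- 1ℚ) :* ((x :+ y) :+ x) :+ y := con (ι -[1+ 1 ]) :* x) refl (X t) (X (ℤ.pred t)) ⟩
    ι -[1+ 1 ] * X t ∎
    where open ℚSolver

neighbourSum^-gibonacci : ∀ {X} → IsGibonacci X → ∀ k → IsGibonacci (neighbourSum^ k X)
neighbourSum^-gibonacci gib zero = gib
neighbourSum^-gibonacci gib (suc k) = neighbourSum-gibonacci (neighbourSum^-gibonacci gib k)

neighbourSum^-even : ∀ {X} → IsGibonacci X → ∀ i t → neighbourSum^ (2 ℕ.* i) X t ≡ ι (+ 5) ^ℚ i * X t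
neighbourSum^-even {X} gib zero t = sym (ℚP.*-identityˡ (X t))
neighbourSum^-even {X} gib (suc i) t = begin
  neighbourSum^ (2 ℕ.* suc i) X t
    ≡⟨ cong (λ k → neighbourSum^ k X t) (ℕP.*-suc 2 i) ⟩
  neighbourSum (neighbourSum (neighbourSum^ (2 ℕ.* i) X)) t
    ≡⟨ neighbourSum-square (neighbourSum^-gibonacci gib (2 ℕ.* i)) t ⟩
  ι (+ 5) * neighbourSum^ (2 ℕ.* i) X t
    ≡⟨ cong (ι (+ 5) *_) (neighbourSum^-even gib i t) ⟩
  ι (+ 5) * (ι (+ 5) ^ℚ i * X t)
    ≡⟨ sym (ℚP.*-assoc (ι (+ 5)) (ι (+ 5) ^ℚ i) (X t)) ⟩
  ι (+ 5) ^ℚ suc i * X t ∎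

neighbourSum^-odd : ∀ {X} → IsGibonacci X → ∀ i t →
  neighbourSum^ (suc (2 ℕ.* i)) X t ≡ ι (+ 5) ^ℚ i * neighbourSum X t
neighbourSum^-odd {X} gib i t =
  trans (cong₂ _+_ (neighbourSum^-even gib i (ℤ.suc t)) (neighbourSum^-even gib i (ℤ.pred t)))
        (sym (ℚP.*-distribˡ-+ (ι (+ 5) ^ℚ i) (X (ℤ.suc t)) (X (ℤ.pred t))))

-- The binomial expansion of ((D + εE³)ᵐ X)(s), with D = neighbourSum.
binomialSum : ℚ → (ℤ → ℚ) → ℕ → ℤ → ℚ
binomialSum ε X m s = sumTo m (λ j → ιℕ (m C j) * (ε ^ℚ j * neighbourSum^ (m ∸ j) X (+ (3 ℕ.* j) ℤ.+ s)))

binomialSum-suc : ∀ ε X m s →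
  binomialSum ε X (suc m) s ≡ neighbourSum (binomialSum ε X m) s + ε * binomialSum ε X m (+ 3 ℤ.+ s)
binomialSum-suc ε X m s = begin
  binomialSum ε X (suc m) s
    ≡⟨ sumTo-pascal m (λ k j → ε ^ℚ j * neighbourSum^ k X (+ (3 ℕ.* j) ℤ.+ s)) ⟩
  sumTo m (λ j → ιℕ (m C j) * (ε ^ℚ j * neighbourSum (neighbourSum^ (m ∸ j) X) (+ (3 ℕ.* j) ℤ.+ s)))
    + sumTo m (λ j → ιℕ (m C j) * (ε ^ℚ suc j * neighbourSum^ (m ∸ j) X (+ (3 ℕ.* suc j) ℤ.+ s)))
    ≡⟨ cong₂ _+_ (trans (sumTo-cong m (λ j _ → neighbours j)) (sumTo-+ m _ _))
                 (trans (sumTo-cong m (λ j _ → shifted j)) (sumTo-*ˡ m ε _)) ⟩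
  neighbourSum (binomialSum ε X m) s + ε * binomialSum ε X m (+ 3 ℤ.+ s) ∎
  where
  open ℚSolver
  term : ℕ → ℤ → ℚ
  term j u = ιℕ (m C j) * (ε ^ℚ j * neighbourSum^ (m ∸ j) X u)
  neighbours : ∀ j → ιℕ (m C j) * (ε ^ℚ j * neighbourSum (neighbourSum^ (m ∸ j) X) (+ (3 ℕ.* j) ℤ.+ s))
                   ≡ term j (+ (3 ℕ.* j) ℤ.+ ℤ.suc s) + term j (+ (3 ℕ.* j) ℤ.+ ℤ.pred s)
  neighbours j = begin
    ιℕ (m C j) * (ε ^ℚ j * (Y (ℤ.suc (+ (3 ℕ.* j) ℤ.+ s)) + Y (ℤ.pred (+ (3 ℕ.* j) ℤ.+ s))))
      ≡⟨ cong₂ (λ u v → ιℕ (m C j) * (ε ^ℚ j * (Y u + Y v)))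
               (ℤ+.x∙yz≈y∙xz (+ 1) (+ (3 ℕ.* j)) s) (ℤ+.x∙yz≈y∙xz -[1+ 0 ] (+ (3 ℕ.* j)) s) ⟩
    ιℕ (m C j) * (ε ^ℚ j * (Y (+ (3 ℕ.* j) ℤ.+ ℤ.suc s) + Y (+ (3 ℕ.* j) ℤ.+ ℤ.pred s)))
      ≡⟨ solve 4 (λ c e y z → c :* (e :* (y :+ z)) := c :* (e :* y) :+ c :* (e :* z)) refl
           (ιℕ (m C j)) (ε ^ℚ j) (Y (+ (3 ℕ.* j) ℤ.+ ℤ.suc s)) (Y (+ (3 ℕ.* j) ℤ.+ ℤ.pred s)) ⟩
    term j (+ (3 ℕ.* j) ℤ.+ ℤ.suc s) + term j (+ (3 ℕ.* j) ℤ.+ ℤ.pred s) ∎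
    where
    Y : ℤ → ℚ
    Y = neighbourSum^ (m ∸ j) X
  shifted : ∀ j → ιℕ (m C j) * (ε ^ℚ suc j * neighbourSum^ (m ∸ j) X (+ (3 ℕ.* suc j) ℤ.+ s))
                ≡ ε * term j (+ (3 ℕ.* j) ℤ.+ (+ 3 ℤ.+ s))
  shifted j = begin
    ιℕ (m C j) * (ε * ε ^ℚ j * Y (+ (3 ℕ.* suc j) ℤ.+ s))
      ≡⟨ cong (λ u → ιℕ (m C j) * (ε * ε ^ℚ j * Y u)) index ⟩
    ιℕ (m C j) * (ε * ε ^ℚ j * Y (+ (3 ℕ.* j) ℤ.+ (+ 3 ℤ.+ s)))
      ≡⟨ solve 4 (λ c ε e y → c :* (ε :* e :* y) := ε :* (c :* (e :* y))) refl
           (ιℕ (m C j)) ε (ε ^ℚ j) (Y (+ (3 ℕ.* j) ℤ.+ (+ 3 ℤ.+ s))) ⟩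
    ε * term j (+ (3 ℕ.* j) ℤ.+ (+ 3 ℤ.+ s)) ∎
    where
    Y : ℤ → ℚ
    Y = neighbourSum^ (m ∸ j) X
    index : + (3 ℕ.* suc j) ℤ.+ s ≡ + (3 ℕ.* j) ℤ.+ (+ 3 ℤ.+ s)
    index = begin
      + (3 ℕ.* suc j) ℤ.+ s         ≡⟨ cong (λ n → + n ℤ.+ s) (ℕP.*-suc 3 j) ⟩
      (+ 3 ℤ.+ + (3 ℕ.* j)) ℤ.+ s   ≡⟨ ℤP.+-assoc (+ 3) (+ (3 ℕ.* j)) s ⟩
      + 3 ℤ.+ (+ (3 ℕ.* j) ℤ.+ s)   ≡⟨ ℤ+.x∙yz≈y∙xz (+ 3) (+ (3 ℕ.* j)) s ⟩
      + (3 ℕ.* j) ℤ.+ (+ 3 ℤ.+ s)   ∎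

binomialSum-one : ∀ {X} → IsGibonacci X → ∀ m s → binomialSum 1ℚ X m s ≡ ι (+ 4) ^ℚ m * X (+ m ℤ.+ s)
binomialSum-one {X} gib zero s = ℚP.*-identityˡ _
binomialSum-one {X} gib (suc m) s = begin
  binomialSum 1ℚ X (suc m) s
    ≡⟨ binomialSum-suc 1ℚ X m s ⟩
  neighbourSum (binomialSum 1ℚ X m) s + 1ℚ * binomialSum 1ℚ X m (+ 3 ℤ.+ s)
    ≡⟨ cong₂ _+_ (cong₂ _+_ (shifted (+ 1)) (shifted -[1+ 0 ])) (cong (1ℚ *_) (shifted (+ 3))) ⟩
  (c * X (ℤ.suc t) + c * X (ℤ.pred t)) + 1ℚ * (c * X (+ 3 ℤ.+ t))
    ≡⟨ solve 4 (λ c x y z → (c :* x :+ c :* y) :+ con 1ℚ :* (c :* z) := c :* ((x :+ y) :+ z)) refl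
         c (X (ℤ.suc t)) (X (ℤ.pred t)) (X (+ 3 ℤ.+ t)) ⟩
  c * (neighbourSum X t + X (+ 3 ℤ.+ t))
    ≡⟨ cong (c *_) (neighbourSum+shift³ gib t) ⟩
  c * (ι (+ 4) * X (ℤ.suc t))
    ≡⟨ solve 3 (λ c f x → c :* (f :* x) := f :* c :* x) refl c (ι (+ 4)) (X (ℤ.suc t)) ⟩
  ι (+ 4) ^ℚ suc m * X (ℤ.suc t)
    ≡⟨ cong (λ u → ι (+ 4) ^ℚ suc m * X u) (sym (ℤP.suc-+ m s)) ⟩
  ι (+ 4) ^ℚ suc m * X (+ suc m ℤ.+ s) ∎
  where
  open ℚSolver
  c : ℚ
  c = ι (+ 4) ^ℚ m
  t : ℤ
  t = + m ℤ.+ s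
  shifted : ∀ i → binomialSum 1ℚ X m (i ℤ.+ s) ≡ c * X (i ℤ.+ t)
  shifted i = trans (binomialSum-one gib m (i ℤ.+ s)) (cong (λ u → c * X u) (ℤ+.x∙yz≈y∙xz (+ m) i s))

binomialSum-minusOne : ∀ {X} → IsGibonacci X → ∀ m s → binomialSum (- 1ℚ) X m s ≡ ι -[1+ 1 ] ^ℚ m * X s
binomialSum-minusOne {X} gib zero s = trans (ℚP.*-identityˡ _) (cong (λ u → 1ℚ * X u) (ℤP.+-identityˡ s))
binomialSum-minusOne {X} gib (suc m) s = begin
  binomialSum (- 1ℚ) X (suc m) s
    ≡⟨ binomialSum-suc (- 1ℚ) X m s ⟩
  neighbourSum (binomialSum (- 1ℚ) X m) s + (- 1ℚ) * binomialSum (- 1ℚ) X m (+ 3 ℤ.+ s)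
    ≡⟨ cong₂ _+_ (cong₂ _+_ (ih (ℤ.suc s)) (ih (ℤ.pred s))) (cong ((- 1ℚ) *_) (ih (+ 3 ℤ.+ s))) ⟩
  (c * X (ℤ.suc s) + c * X (ℤ.pred s)) + (- 1ℚ) * (c * X (+ 3 ℤ.+ s))
    ≡⟨ solve 4 (λ c x y z → (c :* x :+ c :* y) :+ con (- 1ℚ) :* (c :* z) := c :* ((x :+ y) :+ con (- 1ℚ) :* z)) refl
         c (X (ℤ.suc s)) (X (ℤ.pred s)) (X (+ 3 ℤ.+ s)) ⟩
  c * (neighbourSum X s + (- 1ℚ) * X (+ 3 ℤ.+ s))
    ≡⟨ cong (c *_) (neighbourSum-shift³ gib s) ⟩
  c * (ι -[1+ 1 ] * X s)
    ≡⟨ solve 3 (λ c f x → c :* (f :* x) := f :* c :* x) refl c (ι -[1+ 1 ]) (X s) ⟩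
  ι -[1+ 1 ] ^ℚ suc m * X s ∎
  where
  open ℚSolver
  c : ℚ
  c = ι -[1+ 1 ] ^ℚ m
  ih : ∀ u → binomialSum (- 1ℚ) X m u ≡ c * X u
  ih = binomialSum-minusOne gib m

twiceIfEven : ℕ → ℚ
twiceIfEven j = 1ℚ ^ℚ j + (- 1ℚ) ^ℚ j

twiceIfEven-even : ∀ k → twiceIfEven (2 ℕ.* k) ≡ ι (+ 2)
twiceIfEven-even k = cong₂ _+_ (^ℚ-even refl k) (^ℚ-even refl k)

twiceIfEven-odd : ∀ k → twiceIfEven (suc (2 ℕ.* k)) ≡ 0ℚ
twiceIfEven-odd k = cong₂ (λ u v → 1ℚ * u + (- 1ℚ) * v) (^ℚ-even refl k) (^ℚ-even refl k)

twiceIfEven-odd-zeroˡ : ∀ n (f : ℕ → ℚ) → twiceIfEven (suc (2 ℕ.* n)) * f (suc (2 ℕ.* n)) ≡ 0ℚ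
twiceIfEven-odd-zeroˡ n f = trans (cong (_* f (suc (2 ℕ.* n))) (twiceIfEven-odd n)) (ℚP.*-zeroˡ (f (suc (2 ℕ.* n))))

sumTo-evens : ∀ n (f : ℕ → ℚ) → sumTo (2 ℕ.* n) (λ j → twiceIfEven j * f j) ≡ ι (+ 2) * sumTo n (λ k → f (2 ℕ.* k))
sumTo-evens zero f = refl
sumTo-evens (suc n) f = begin
  sumTo (2 ℕ.* suc n) g
    ≡⟨ cong (λ m → sumTo m g) (ℕP.*-suc 2 n) ⟩
  sumTo (suc (2 ℕ.* n)) g + g (2 ℕ.+ 2 ℕ.* n)
    ≡⟨ cong₂ _+_ (sumTo-suc-zero (2 ℕ.* n) g (twiceIfEven-odd-zeroˡ n f)) (cong g (sym (ℕP.*-suc 2 n))) ⟩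
  sumTo (2 ℕ.* n) g + g (2 ℕ.* suc n)
    ≡⟨ cong₂ _+_ (sumTo-evens n f) (cong (_* f (2 ℕ.* suc n)) (twiceIfEven-even (suc n))) ⟩
  ι (+ 2) * sumTo n (λ k → f (2 ℕ.* k)) + ι (+ 2) * f (2 ℕ.* suc n)
    ≡⟨ sym (ℚP.*-distribˡ-+ (ι (+ 2)) (sumTo n (λ k → f (2 ℕ.* k))) (f (2 ℕ.* suc n))) ⟩
  ι (+ 2) * sumTo (suc n) (λ k → f (2 ℕ.* k)) ∎
  where
  g : ℕ → ℚ
  g j = twiceIfEven j * f j

sumTo-evens-suc : ∀ n (f : ℕ → ℚ) →
  sumTo (suc (2 ℕ.* n)) (λ j → twiceIfEven j * f j) ≡ ι (+ 2) * sumTo n (λ k → f (2 ℕ.* k))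
sumTo-evens-suc n f = trans (sumTo-suc-zero (2 ℕ.* n) _ (twiceIfEven-odd-zeroˡ n f)) (sumTo-evens n f)

binomialSum-one+minusOne : ∀ X m s → binomialSum 1ℚ X m s + binomialSum (- 1ℚ) X m s
  ≡ sumTo m (λ j → twiceIfEven j * (ιℕ (m C j) * neighbourSum^ (m ∸ j) X (+ (3 ℕ.* j) ℤ.+ s)))
binomialSum-one+minusOne X m s = trans (sym (sumTo-+ m _ _)) (sumTo-cong m λ j _ →
  solve 4 (λ c a b y → c :* (a :* y) :+ c :* (b :* y) := (a :+ b) :* (c :* y)) refl
    (ιℕ (m C j)) (1ℚ ^ℚ j) ((- 1ℚ) ^ℚ j) (neighbourSum^ (m ∸ j) X (+ (3 ℕ.* j) ℤ.+ s)))
  where open ℚSolver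

binomialSum-evens : ∀ {X} → IsGibonacci X → ∀ n s →
  ι (+ 2) * sumTo n (λ k → ι (+ 5) ^ℚ (n ∸ k) * (ιℕ ((2 ℕ.* n) C (2 ℕ.* k)) * X (+ (6 ℕ.* k) ℤ.+ s)))
    ≡ ι (+ 4) ^ℚ (2 ℕ.* n) * X (+ (2 ℕ.* n) ℤ.+ s) + ι -[1+ 1 ] ^ℚ (2 ℕ.* n) * X s
binomialSum-evens {X} gib n s = begin
  ι (+ 2) * sumTo n (λ k → ι (+ 5) ^ℚ (n ∸ k) * (ιℕ (m C (2 ℕ.* k)) * X (+ (6 ℕ.* k) ℤ.+ s)))
    ≡⟨ cong (ι (+ 2) *_) (sumTo-cong n term) ⟩
  ι (+ 2) * sumTo n (λ k → T (2 ℕ.* k))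
    ≡⟨ sym (sumTo-evens n T) ⟩
  sumTo m (λ j → twiceIfEven j * T j)
    ≡⟨ sym (binomialSum-one+minusOne X m s) ⟩
  binomialSum 1ℚ X m s + binomialSum (- 1ℚ) X m s
    ≡⟨ cong₂ _+_ (binomialSum-one gib m s) (binomialSum-minusOne gib m s) ⟩
  ι (+ 4) ^ℚ m * X (+ m ℤ.+ s) + ι -[1+ 1 ] ^ℚ m * X s ∎
  where
  open ℚSolver
  m : ℕ
  m = 2 ℕ.* n
  T : ℕ → ℚ
  T j = ιℕ (m C j) * neighbourSum^ (m ∸ j) X (+ (3 ℕ.* j) ℤ.+ s)
  term : ∀ k → k ℕ.≤ n → ι (+ 5) ^ℚ (n ∸ k) * (ιℕ (m C (2 ℕ.* k)) * X (+ (6 ℕ.* k) ℤ.+ s)) ≡ T (2 ℕ.* k)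
  term k _ = sym (begin
    ιℕ (m C (2 ℕ.* k)) * neighbourSum^ (m ∸ 2 ℕ.* k) X (+ (3 ℕ.* (2 ℕ.* k)) ℤ.+ s)
      ≡⟨ cong₂ (λ d i → ιℕ (m C (2 ℕ.* k)) * neighbourSum^ d X (+ i ℤ.+ s))
               (sym (ℕP.*-distribˡ-∸ 2 n k)) (sym (ℕP.*-assoc 3 2 k)) ⟩
    ιℕ (m C (2 ℕ.* k)) * neighbourSum^ (2 ℕ.* (n ∸ k)) X (+ (6 ℕ.* k) ℤ.+ s)
      ≡⟨ cong (ιℕ (m C (2 ℕ.* k)) *_) (neighbourSum^-even gib (n ∸ k) _) ⟩
    ιℕ (m C (2 ℕ.* k)) * (ι (+ 5) ^ℚ (n ∸ k) * X (+ (6 ℕ.* k) ℤ.+ s))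
      ≡⟨ solve 3 (λ c p x → c :* (p :* x) := p :* (c :* x)) refl
           (ιℕ (m C (2 ℕ.* k))) (ι (+ 5) ^ℚ (n ∸ k)) (X (+ (6 ℕ.* k) ℤ.+ s)) ⟩
    ι (+ 5) ^ℚ (n ∸ k) * (ιℕ (m C (2 ℕ.* k)) * X (+ (6 ℕ.* k) ℤ.+ s)) ∎)

binomialSum-odds : ∀ {X} → IsGibonacci X → ∀ n s →
  ι (+ 2) * sumTo n (λ k → ι (+ 5) ^ℚ (n ∸ k) * (ιℕ (suc (2 ℕ.* n) C (2 ℕ.* k)) * neighbourSum X (+ (6 ℕ.* k) ℤ.+ s)))
    ≡ ι (+ 4) ^ℚ suc (2 ℕ.* n) * X (+ suc (2 ℕ.* n) ℤ.+ s) + ι -[1+ 1 ] ^ℚ suc (2 ℕ.* n) * X s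
binomialSum-odds {X} gib n s = begin
  ι (+ 2) * sumTo n (λ k → ι (+ 5) ^ℚ (n ∸ k) * (ιℕ (m C (2 ℕ.* k)) * neighbourSum X (+ (6 ℕ.* k) ℤ.+ s)))
    ≡⟨ cong (ι (+ 2) *_) (sumTo-cong n term) ⟩
  ι (+ 2) * sumTo n (λ k → T (2 ℕ.* k))
    ≡⟨ sym (sumTo-evens-suc n T) ⟩
  sumTo m (λ j → twiceIfEven j * T j)
    ≡⟨ sym (binomialSum-one+minusOne X m s) ⟩
  binomialSum 1ℚ X m s + binomialSum (- 1ℚ) X m s
    ≡⟨ cong₂ _+_ (binomialSum-one gib m s) (binomialSum-minusOne gib m s) ⟩
  ι (+ 4) ^ℚ m * X (+ m ℤ.+ s) + ι -[1+ 1 ] ^ℚ m * X s ∎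
  where
  open ℚSolver
  m : ℕ
  m = suc (2 ℕ.* n)
  T : ℕ → ℚ
  T j = ιℕ (m C j) * neighbourSum^ (m ∸ j) X (+ (3 ℕ.* j) ℤ.+ s)
  term : ∀ k → k ℕ.≤ n →
         ι (+ 5) ^ℚ (n ∸ k) * (ιℕ (m C (2 ℕ.* k)) * neighbourSum X (+ (6 ℕ.* k) ℤ.+ s)) ≡ T (2 ℕ.* k)
  term k k≤n = sym (begin
    ιℕ (m C (2 ℕ.* k)) * neighbourSum^ (m ∸ 2 ℕ.* k) X (+ (3 ℕ.* (2 ℕ.* k)) ℤ.+ s)
      ≡⟨ cong₂ (λ d i → ιℕ (m C (2 ℕ.* k)) * neighbourSum^ d X (+ i ℤ.+ s))
               (trans (ℕP.+-∸-assoc 1 (ℕP.*-monoʳ-≤ 2 k≤n)) (cong suc (sym (ℕP.*-distribˡ-∸ 2 n k))))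
               (sym (ℕP.*-assoc 3 2 k)) ⟩
    ιℕ (m C (2 ℕ.* k)) * neighbourSum^ (suc (2 ℕ.* (n ∸ k))) X (+ (6 ℕ.* k) ℤ.+ s)
      ≡⟨ cong (ιℕ (m C (2 ℕ.* k)) *_) (neighbourSum^-odd gib (n ∸ k) (+ (6 ℕ.* k) ℤ.+ s)) ⟩
    ιℕ (m C (2 ℕ.* k)) * (ι (+ 5) ^ℚ (n ∸ k) * neighbourSum X (+ (6 ℕ.* k) ℤ.+ s))
      ≡⟨ solve 3 (λ c p x → c :* (p :* x) := p :* (c :* x)) refl
           (ιℕ (m C (2 ℕ.* k))) (ι (+ 5) ^ℚ (n ∸ k)) (neighbourSum X (+ (6 ℕ.* k) ℤ.+ s)) ⟩
    ι (+ 5) ^ℚ (n ∸ k) * (ιℕ (m C (2 ℕ.* k)) * neighbourSum X (+ (6 ℕ.* k) ℤ.+ s)) ∎)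

4^[2n] : ∀ n → ι (+ 4) ^ℚ (2 ℕ.* n) ≡ ι (+ 4) ^ℚ n * ι (+ 4) ^ℚ n
4^[2n] n = trans (^ℚ-double (ι (+ 4)) n) (^ℚ-distrib-* (ι (+ 4)) (ι (+ 4)) n)

[-2]^[2n] : ∀ n → ι -[1+ 1 ] ^ℚ (2 ℕ.* n) ≡ ι (+ 4) ^ℚ n
[-2]^[2n] = ^ℚ-double (ι -[1+ 1 ])

[4/5]^n : ∀ n → (+ 4 ℚ./ 5) ^ℚ n ≡ ι (+ 4) ^ℚ n * (+ 1 ℚ./ 5) ^ℚ n
[4/5]^n = ^ℚ-distrib-* (ι (+ 4)) (+ 1 ℚ./ 5)

gibonacci-even-identity : (G : ℤ → ℤ) → IsGibonacci (ι ∘ G) → ∀ n s →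
  ι (+ 2) * sumTo n (λ k → ιℕ ((2 ℕ.* n) C (2 ℕ.* k)) * ι (G (+ (6 ℕ.* k) ℤ.+ s)) * (+ 1 ℚ./ 5) ^ℚ k)
    ≡ (+ 4 ℚ./ 5) ^ℚ n * ι ((+ 4) ℤ.^ n ℤ.* G (+ (2 ℕ.* n) ℤ.+ s) ℤ.+ G s)
gibonacci-even-identity G gib n s = begin
  ι (+ 2) * sumTo n (λ k → ιℕ ((2 ℕ.* n) C (2 ℕ.* k)) * ι (G (+ (6 ℕ.* k) ℤ.+ s)) * q ^ℚ k)
    ≡⟨ cong (ι (+ 2) *_) (sumTo-rescale refl n _) ⟩
  ι (+ 2) * (q ^ℚ n * S)
    ≡⟨ solve 3 (λ a b c → a :* (b :* c) := b :* (a :* c)) refl (ι (+ 2)) (q ^ℚ n) S ⟩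
  q ^ℚ n * (ι (+ 2) * S)
    ≡⟨ cong (q ^ℚ n *_) (binomialSum-evens gib n s) ⟩
  q ^ℚ n * (ι (+ 4) ^ℚ (2 ℕ.* n) * g + ι -[1+ 1 ] ^ℚ (2 ℕ.* n) * gₛ)
    ≡⟨ cong₂ (λ a b → q ^ℚ n * (a * g + b * gₛ)) (4^[2n] n) ([-2]^[2n] n) ⟩
  q ^ℚ n * (c * c * g + c * gₛ)
    ≡⟨ solve 4 (λ q c g h → q :* (c :* c :* g :+ c :* h) := (c :* q) :* (c :* g :+ h)) refl (q ^ℚ n) c g gₛ ⟩
  (c * q ^ℚ n) * (c * g + gₛ)
    ≡⟨ cong₂ _*_ (sym ([4/5]^n n)) (sym ι-rhs) ⟩
  (+ 4 ℚ./ 5) ^ℚ n * ι ((+ 4) ℤ.^ n ℤ.* G (+ (2 ℕ.* n) ℤ.+ s) ℤ.+ G s) ∎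
  where
  open ℚSolver
  q c g gₛ S : ℚ
  q = + 1 ℚ./ 5
  c = ι (+ 4) ^ℚ n
  g = ι (G (+ (2 ℕ.* n) ℤ.+ s))
  gₛ = ι (G s)
  S = sumTo n (λ k → ι (+ 5) ^ℚ (n ∸ k) * (ιℕ ((2 ℕ.* n) C (2 ℕ.* k)) * ι (G (+ (6 ℕ.* k) ℤ.+ s))))
  ι-rhs : ι ((+ 4) ℤ.^ n ℤ.* G (+ (2 ℕ.* n) ℤ.+ s) ℤ.+ G s) ≡ c * g + gₛ
  ι-rhs = trans (ι-+ ((+ 4) ℤ.^ n ℤ.* G (+ (2 ℕ.* n) ℤ.+ s)) (G s))
                (cong (_+ gₛ) (trans (ι-* ((+ 4) ℤ.^ n) (G (+ (2 ℕ.* n) ℤ.+ s))) (cong (_* g) (ι-^ (+ 4) n))))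

gibonacci-odd-identity : (G : ℤ → ℤ) → IsGibonacci (ι ∘ G) → ∀ n s →
  ι (+ 2) * sumTo (suc n)
      (λ k → ιℕ (suc (2 ℕ.* n) C (2 ℕ.* k)) * neighbourSum (ι ∘ G) (+ (6 ℕ.* k) ℤ.+ s) * (+ 1 ℚ./ 5) ^ℚ k)
    ≡ (+ 4 ℚ./ 5) ^ℚ n * ι ((+ 4) ℤ.^ suc n ℤ.* G (+ suc (2 ℕ.* n) ℤ.+ s) ℤ.- (+ 2) ℤ.* G s)
gibonacci-odd-identity G gib n s = begin
  ι (+ 2) * sumTo (suc n) f
    ≡⟨ cong (ι (+ 2) *_) (trans (sumTo-suc-zero n f lastTerm≡0) (sumTo-rescale refl n _)) ⟩
  ι (+ 2) * (q ^ℚ n * S)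
    ≡⟨ solve 3 (λ a b c → a :* (b :* c) := b :* (a :* c)) refl (ι (+ 2)) (q ^ℚ n) S ⟩
  q ^ℚ n * (ι (+ 2) * S)
    ≡⟨ cong (q ^ℚ n *_) (binomialSum-odds gib n s) ⟩
  q ^ℚ n * (ι (+ 4) * ι (+ 4) ^ℚ (2 ℕ.* n) * g + ι -[1+ 1 ] * ι -[1+ 1 ] ^ℚ (2 ℕ.* n) * gₛ)
    ≡⟨ cong₂ (λ a b → q ^ℚ n * (ι (+ 4) * a * g + ι -[1+ 1 ] * b * gₛ)) (4^[2n] n) ([-2]^[2n] n) ⟩
  q ^ℚ n * (ι (+ 4) * (c * c) * g + ι -[1+ 1 ] * c * gₛ)
    ≡⟨ solve 4 (λ q c g h → q :* (con (ι (+ 4)) :* (c :* c) :* g :+ con (ι -[1+ 1 ]) :* c :* h)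
                          := (c :* q) :* (con (ι (+ 4)) :* c :* g :+ con (ι -[1+ 1 ]) :* h)) refl (q ^ℚ n) c g gₛ ⟩
  (c * q ^ℚ n) * (ι (+ 4) * c * g + ι -[1+ 1 ] * gₛ)
    ≡⟨ cong₂ _*_ (sym ([4/5]^n n)) (sym ι-rhs) ⟩
  (+ 4 ℚ./ 5) ^ℚ n * ι ((+ 4) ℤ.^ suc n ℤ.* G (+ suc (2 ℕ.* n) ℤ.+ s) ℤ.- (+ 2) ℤ.* G s) ∎
  where
  open ℚSolver
  q c g gₛ S : ℚ
  q = + 1 ℚ./ 5
  c = ι (+ 4) ^ℚ n
  g = ι (G (+ suc (2 ℕ.* n) ℤ.+ s))
  gₛ = ι (G s)
  f : ℕ → ℚ
  f k = ιℕ (suc (2 ℕ.* n) C (2 ℕ.* k)) * neighbourSum (ι ∘ G) (+ (6 ℕ.* k) ℤ.+ s) * q ^ℚ k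
  S = sumTo n (λ k → ι (+ 5) ^ℚ (n ∸ k)
                      * (ιℕ (suc (2 ℕ.* n) C (2 ℕ.* k)) * neighbourSum (ι ∘ G) (+ (6 ℕ.* k) ℤ.+ s)))
  lastTerm≡0 : f (suc n) ≡ 0ℚ
  lastTerm≡0 = begin
    ιℕ (suc (2 ℕ.* n) C (2 ℕ.* suc n)) * y * q ^ℚ suc n
      ≡⟨ cong (λ i → ιℕ (suc (2 ℕ.* n) C i) * y * q ^ℚ suc n) (ℕP.*-suc 2 n) ⟩
    ιℕ (suc (2 ℕ.* n) C (2 ℕ.+ 2 ℕ.* n)) * y * q ^ℚ suc n
      ≡⟨ cong (λ b → ιℕ b * y * q ^ℚ suc n) (k>n⇒nCk≡0 (ℕP.n<1+n (suc (2 ℕ.* n)))) ⟩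
    0ℚ * y * q ^ℚ suc n
      ≡⟨ trans (cong (_* q ^ℚ suc n) (ℚP.*-zeroˡ y)) (ℚP.*-zeroˡ (q ^ℚ suc n)) ⟩
    0ℚ ∎
    where
    y : ℚ
    y = neighbourSum (ι ∘ G) (+ (6 ℕ.* suc n) ℤ.+ s)
  ι-rhs : ι ((+ 4) ℤ.^ suc n ℤ.* G (+ suc (2 ℕ.* n) ℤ.+ s) ℤ.- (+ 2) ℤ.* G s) ≡ ι (+ 4) * c * g + ι -[1+ 1 ] * gₛ
  ι-rhs = begin
    ι ((+ 4) ℤ.^ suc n ℤ.* G (+ suc (2 ℕ.* n) ℤ.+ s) ℤ.+ ℤ.- ((+ 2) ℤ.* G s))
      ≡⟨ cong (λ x → ι ((+ 4) ℤ.^ suc n ℤ.* G (+ suc (2 ℕ.* n) ℤ.+ s) ℤ.+ x)) (ℤP.neg-distribˡ-* (+ 2) (G s)) ⟩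
    ι ((+ 4) ℤ.^ suc n ℤ.* G (+ suc (2 ℕ.* n) ℤ.+ s) ℤ.+ -[1+ 1 ] ℤ.* G s)
      ≡⟨ ι-+ ((+ 4) ℤ.^ suc n ℤ.* G (+ suc (2 ℕ.* n) ℤ.+ s)) (-[1+ 1 ] ℤ.* G s) ⟩
    ι ((+ 4) ℤ.^ suc n ℤ.* G (+ suc (2 ℕ.* n) ℤ.+ s)) + ι (-[1+ 1 ] ℤ.* G s)
      ≡⟨ cong₂ _+_ (trans (ι-* ((+ 4) ℤ.^ suc n) (G (+ suc (2 ℕ.* n) ℤ.+ s))) (cong (_* g) (ι-^ (+ 4) (suc n))))
                   (ι-* -[1+ 1 ] (G s)) ⟩
    ι (+ 4) * c * g + ι -[1+ 1 ] * gₛ ∎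

F-gibonacci : IsGibonacci (ι ∘ F)
F-gibonacci = gibonacci λ t → trans (cong ι (F-recurrence t)) (ι-+ (F (ℤ.suc t)) (F t))

neighbourSum-F : ∀ t → neighbourSum (ι ∘ F) t ≡ ι (L t)
neighbourSum-F t = sym (trans (cong ι (L≡F[t+1]+F[t-1] t)) (ι-+ (F (ℤ.suc t)) (F (ℤ.pred t))))

L-gibonacci : IsGibonacci (ι ∘ L)
L-gibonacci = gibonacci λ t → begin
  ι (L (ℤ.suc (ℤ.suc t)))
    ≡⟨ sym (neighbourSum-F (ℤ.suc (ℤ.suc t))) ⟩
  neighbourSum (ι ∘ F) (ℤ.suc (ℤ.suc t))
    ≡⟨ IsGibonacci.recurrence (neighbourSum-gibonacci F-gibonacci) t ⟩
  neighbourSum (ι ∘ F) (ℤ.suc t) + neighbourSum (ι ∘ F) t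
    ≡⟨ cong₂ _+_ (neighbourSum-F (ℤ.suc t)) (neighbourSum-F t) ⟩
  ι (L (ℤ.suc t)) + ι (L t) ∎

neighbourSum-L : ∀ t → neighbourSum (ι ∘ L) t ≡ ι (+ 5) * ι (F t)
neighbourSum-L t = trans (cong₂ _+_ (sym (neighbourSum-F (ℤ.suc t))) (sym (neighbourSum-F (ℤ.pred t))))
                         (neighbourSum-square F-gibonacci t)

2[1+n]∸1≡1+2n : ∀ n → 2 ℕ.* suc n ∸ 1 ≡ suc (2 ℕ.* n)
2[1+n]∸1≡1+2n n = cong (_∸ 1) (ℕP.*-suc 2 n)

fibonacci-odd-identity : ∀ {m} n s → m ≡ suc (2 ℕ.* n) →
  ι (+ 8) * sumTo (suc n) (λ k → ιℕ (m C (2 ℕ.* k)) * ι (F (+ (6 ℕ.* k) ℤ.+ s)) * (+ 1 ℚ./ 5) ^ℚ k)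
    ≡ (+ 4 ℚ./ 5) ^ℚ suc n * ι ((+ 4) ℤ.^ suc n ℤ.* L (+ m ℤ.+ s) ℤ.- (+ 2) ℤ.* L s)
fibonacci-odd-identity {m} n s refl = begin
  ι (+ 8) * S
    ≡⟨ solve 1 (λ x → con (ι (+ 8)) :* x := con (+ 4 ℚ./ 5) :* (con (ι (+ 2)) :* (con (ι (+ 5)) :* x)))
         refl S ⟩
  (+ 4 ℚ./ 5) * (ι (+ 2) * (ι (+ 5) * S))
    ≡⟨ cong (λ x → (+ 4 ℚ./ 5) * (ι (+ 2) * x))
            (trans (sym (sumTo-*ˡ (suc n) (ι (+ 5)) _)) (sumTo-cong (suc n) term)) ⟩
  (+ 4 ℚ./ 5)
    * (ι (+ 2) * sumTo (suc n) (λ k → ιℕ (m C (2 ℕ.* k)) * neighbourSum (ι ∘ L) (+ (6 ℕ.* k) ℤ.+ s) * q ^ℚ k))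
    ≡⟨ cong ((+ 4 ℚ./ 5) *_) (gibonacci-odd-identity L L-gibonacci n s) ⟩
  (+ 4 ℚ./ 5) * ((+ 4 ℚ./ 5) ^ℚ n * ι ((+ 4) ℤ.^ suc n ℤ.* L (+ m ℤ.+ s) ℤ.- (+ 2) ℤ.* L s))
    ≡⟨ sym (ℚP.*-assoc (+ 4 ℚ./ 5) ((+ 4 ℚ./ 5) ^ℚ n) _) ⟩
  (+ 4 ℚ./ 5) ^ℚ suc n * ι ((+ 4) ℤ.^ suc n ℤ.* L (+ m ℤ.+ s) ℤ.- (+ 2) ℤ.* L s) ∎
  where
  open ℚSolver
  q S : ℚ
  q = + 1 ℚ./ 5
  S = sumTo (suc n) (λ k → ιℕ (m C (2 ℕ.* k)) * ι (F (+ (6 ℕ.* k) ℤ.+ s)) * q ^ℚ k)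
  term : ∀ k → k ℕ.≤ suc n → ι (+ 5) * (ιℕ (m C (2 ℕ.* k)) * ι (F (+ (6 ℕ.* k) ℤ.+ s)) * q ^ℚ k)
                            ≡ ιℕ (m C (2 ℕ.* k)) * neighbourSum (ι ∘ L) (+ (6 ℕ.* k) ℤ.+ s) * q ^ℚ k
  term k _ = begin
    ι (+ 5) * (ιℕ (m C (2 ℕ.* k)) * ι (F (+ (6 ℕ.* k) ℤ.+ s)) * q ^ℚ k)
      ≡⟨ solve 4 (λ f c x r → f :* (c :* x :* r) := c :* (f :* x) :* r) refl
           (ι (+ 5)) (ιℕ (m C (2 ℕ.* k))) (ι (F (+ (6 ℕ.* k) ℤ.+ s))) (q ^ℚ k) ⟩
    ιℕ (m C (2 ℕ.* k)) * (ι (+ 5) * ι (F (+ (6 ℕ.* k) ℤ.+ s))) * q ^ℚ k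
      ≡⟨ cong (λ x → ιℕ (m C (2 ℕ.* k)) * x * q ^ℚ k) (sym (neighbourSum-L (+ (6 ℕ.* k) ℤ.+ s))) ⟩
    ιℕ (m C (2 ℕ.* k)) * neighbourSum (ι ∘ L) (+ (6 ℕ.* k) ℤ.+ s) * q ^ℚ k ∎

lucas-odd-identity : ∀ {m} n s → m ≡ suc (2 ℕ.* n) →
  ι (+ 2) * sumTo (suc n) (λ k → ιℕ (m C (2 ℕ.* k)) * ι (L (+ (6 ℕ.* k) ℤ.+ s)) * (+ 1 ℚ./ 5) ^ℚ k)
    ≡ (+ 4 ℚ./ 5) ^ℚ n * ι ((+ 4) ℤ.^ suc n ℤ.* F (+ m ℤ.+ s) ℤ.- (+ 2) ℤ.* F s)
lucas-odd-identity n s refl =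
  trans (cong (ι (+ 2) *_) (sumTo-cong (suc n) λ k _ →
          cong (λ x → ιℕ (suc (2 ℕ.* n) C (2 ℕ.* k)) * x * (+ 1 ℚ./ 5) ^ℚ k)
               (sym (neighbourSum-F (+ (6 ℕ.* k) ℤ.+ s)))))
        (gibonacci-odd-identity F F-gibonacci n s)

theorem10 : (s : ℤ) →
    ((n : ℕ) →
      (ι (+ 2) ℚ.* sumTo n (λ k → ιℕ ((2 ℕ.* n) C (2 ℕ.* k)) ℚ.* ι (F (+ (6 ℕ.* k) ℤ.+ s)) ℚ.* ((+ 1 ℚ./ 5) ^ℚ k))
        ≡ ((+ 4 ℚ./ 5) ^ℚ n) ℚ.* ι (((+ 4) ℤ.^ n) ℤ.* F (+ (2 ℕ.* n) ℤ.+ s) ℤ.+ F s))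
      × (ι (+ 2) ℚ.* sumTo n (λ k → ιℕ ((2 ℕ.* n) C (2 ℕ.* k)) ℚ.* ι (L (+ (6 ℕ.* k) ℤ.+ s)) ℚ.* ((+ 1 ℚ./ 5) ^ℚ k))
        ≡ ((+ 4 ℚ./ 5) ^ℚ n) ℚ.* ι (((+ 4) ℤ.^ n) ℤ.* L (+ (2 ℕ.* n) ℤ.+ s) ℤ.+ L s)))
    × ((n : ℕ) → 1 ℕ.≤ n →
      (ι (+ 8) ℚ.* sumTo n (λ k → ιℕ ((2 ℕ.* n ℕ.∸ 1) C (2 ℕ.* k)) ℚ.* ι (F (+ (6 ℕ.* k) ℤ.+ s)) ℚ.* ((+ 1 ℚ./ 5) ^ℚ k))
        ≡ ((+ 4 ℚ./ 5) ^ℚ n) ℚ.* ι (((+ 4) ℤ.^ n) ℤ.* L (+ (2 ℕ.* n ℕ.∸ 1) ℤ.+ s) ℤ.- (+ 2) ℤ.* L s))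
      × (ι (+ 2) ℚ.* sumTo n (λ k → ιℕ ((2 ℕ.* n ℕ.∸ 1) C (2 ℕ.* k)) ℚ.* ι (L (+ (6 ℕ.* k) ℤ.+ s)) ℚ.* ((+ 1 ℚ./ 5) ^ℚ k))
        ≡ ((+ 4 ℚ./ 5) ^ℚ (n ℕ.∸ 1)) ℚ.* ι (((+ 4) ℤ.^ n) ℤ.* F (+ (2 ℕ.* n ℕ.∸ 1) ℤ.+ s) ℤ.- (+ 2) ℤ.* F s)))
theorem10 s =
  (λ n → gibonacci-even-identity F F-gibonacci n s , gibonacci-even-identity L L-gibonacci n s) ,
  λ { (suc n) _ → fibonacci-odd-identity n s (2[1+n]∸1≡1+2n n) , lucas-odd-identity n s (2[1+n]∸1≡1+2n n) }
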